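{- Let $S = \{s_1 < s_2 < \cdots < s_k\} \subseteq \{0,\dots,d\}$ be proper and let $\mathsf{c}(\mathbf{x}) = x_1 + \cdots + x_d$. A sequence of vertices of $\Delta(d,S)$ is a $\mathsf{c}$-monotone path if and only if it has the form $\mathbf{e}_{A_1}, \mathbf{e}_{A_2}, \dots, \mathbf{e}_{A_k}$ with $A_1 \subset A_2 \subset \cdots \subset A_k \subseteq [d]$ and $|A_i| = s_i$ for all $i = 1,\dots,k$.
   Context: For nonempty $S \subseteq \{0,1,\dots,d\}$, $\Delta(d,S) = \operatorname{conv}\{ \mathbf{v} \in \{0,1\}^d : v_1 + \cdots + v_d \in S\}$; $S$ is proper if $\Delta(d,S)$ is $d$-dimensional. $\mathbf{e}_A$ is the indicator vector of $A \subseteq [d]$. For a polytope $P$ and a linear function $\ell$, an $\ell$-monotone path is a sequence of vertices $\mathbf{v}_1,\dots,\mathbf{v}_m$ of $P$ such that each $[\mathbf{v}_i,\mathbf{v}_{i+1}]$ is an edge of $P$ and $\min \ell(P) = \ell(\mathbf{v}_1) < \ell(\mathbf{v}_2) < \cdots < \ell(\mathbf{v}_m) = \max \ell(P)$. -}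

module Defs where

open import Data.Nat using (ℕ; zero; suc)
open import Data.Bool using (Bool; true; false)
open import Data.Fin using (Fin)
open import Data.Fin.Subset using (Subset; ∣_∣)
open import Data.Vec using (lookup)
open import Data.List using (List; []; _∷_)
open import Data.List.Membership.Propositional using (_∈_)
open import Data.List.Relation.Unary.All using (All)
open import Data.List.Relation.Unary.Linked using (Linked)
open import Data.Product using (Σ; _×_; ∃)
open import Data.Rational using (ℚ; 0ℚ; 1ℚ; _+_; _*_; _<_)
open import Relation.Binary.PropositionalEquality using (_≡_; _≢_)
open import Relation.Nullary using (¬_)

-- Points of {0,1}^d are represented as subsets of [d] (Vec Bool d);
-- the subset A stands for its indicator vector e_A.
Pt : ℕ → Set
Pt d = Subset d

-- S ⊆ {0,…,d} is given by the increasing list s₁ < ⋯ < s_k of its elements.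
-- Generating set of Δ(d,S): the 0/1 points whose coordinate sum lies in S.
InS : {d : ℕ} → List ℕ → Pt d → Set
InS ss v = ∣ v ∣ ∈ ss

b2q : Bool → ℚ
b2q true  = 1ℚ
b2q false = 0ℚ

sumℚ : {n : ℕ} → (Fin n → ℚ) → ℚ
sumℚ {zero}  f = 0ℚ
sumℚ {suc n} f = f Fin.zero + sumℚ (λ i → f (Fin.suc i))

val : {d : ℕ} → (Fin d → ℚ) → Pt d → ℚ
val ℓ v = sumℚ (λ j → ℓ j * b2q (lookup v j))

-- v is a vertex of Δ(d,S) = conv V: v ∈ V and some linear functional is
-- maximised on conv V exactly at v.
IsVertex : (d : ℕ) → List ℕ → Pt d → Set
IsVertex d ss v = InS ss v ×
  ∃ λ (ℓ : Fin d → ℚ) → ∀ (w : Pt d) → InS ss w → w ≢ v → val ℓ w < val ℓ v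

-- [u,v] is an edge of Δ(d,S): u ≠ v are points of V and some linear
-- functional attains its maximum over conv V exactly on the segment [u,v]
-- (i.e. exactly at the points u,v of V).
IsEdge : (d : ℕ) → List ℕ → Pt d → Pt d → Set
IsEdge d ss u v = u ≢ v × InS ss u × InS ss v ×
  ∃ λ (ℓ : Fin d → ℚ) → (val ℓ u ≡ val ℓ v) ×
    (∀ (w : Pt d) → InS ss w → w ≢ u → w ≢ v → val ℓ w < val ℓ u)

-- S proper: Δ(d,S) is d-dimensional, i.e. it contains d+1 affinely
-- independent points (it suffices to take them from the generating set V).
AffInd : {d : ℕ} → (Fin (suc d) → Pt d) → Set
AffInd {d} p = ∀ (λs : Fin (suc d) → ℚ) →
  sumℚ λs ≡ 0ℚ →
  (∀ (j : Fin d) → sumℚ (λ i → λs i * b2q (lookup (p i) j)) ≡ 0ℚ) →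
  ∀ i → λs i ≡ 0ℚ

Proper : (d : ℕ) → List ℕ → Set
Proper d ss = ∃ λ (p : Fin (suc d) → Pt d) → (∀ i → InS ss (p i)) × AffInd p

-- c(x) = x₁ + ⋯ + x_d; on the 0/1 point e_A it equals |A|.
c : {d : ℕ} → Pt d → ℕ
c v = ∣ v ∣

data Last {A : Set} : List A → A → Set where
  here  : ∀ {x} → Last (x ∷ []) x
  there : ∀ {x y xs z} → Last (y ∷ xs) z → Last (x ∷ y ∷ xs) z

-- c-monotone path in Δ(d,S): a nonempty sequence of vertices, consecutive
-- ones forming edges, starting at a c-minimiser, ending at a c-maximiser of
-- Δ(d,S) (min/max over a polytope are attained on V), strictly c-increasing.
MonotonePath : (d : ℕ) → List ℕ → List (Pt d) → Set
MonotonePath d ss []       = Data.Empty.⊥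
  where import Data.Empty
MonotonePath d ss (v ∷ vs) =
  All (IsVertex d ss) (v ∷ vs) ×
  Linked (IsEdge d ss) (v ∷ vs) ×
  Linked (λ x y → c x Data.Nat.< c y) (v ∷ vs) ×
  (∀ (w : Pt d) → InS ss w → c v Data.Nat.≤ c w) ×
  Σ (Pt d) (λ z → Last (v ∷ vs) z × (∀ (w : Pt d) → InS ss w → c w Data.Nat.≤ c z))
  where import Data.Nat

-- An edge [e_A, e_B] of Δ(d,S) with |A| < |B| is exactly a pair A ⊆ B with no level of S
-- strictly between |A| and |B|.  If A ⊈ B, pick i ∈ A ∖ B and j ∈ B ∖ A and exchange them in
-- both A and B: the two new points lie on the levels |A| and |B|, and under any linear
-- functional ℓ their values add up to ℓ(e_A) + ℓ(e_B), so they cannot both lie strictly below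
-- an edge on which ℓ is maximal.  If A ⊆ B and a level s of S lies strictly between, a greedy
-- choice of s − |A| elements of B ∖ A gives a point of level s on which ℓ is at least
-- min(ℓ(e_A), ℓ(e_B)).  Conversely, for A ⊆ B the functional that is 1 on A, −1 off B and 0 on
-- B ∖ A is maximised on {0,1}^d exactly on the interval [A, B], which meets the levels of S
-- only in A and B.  So a c-monotone path climbs the levels of S one at a time along a chain of
-- inclusions, from the lowest level s₁ to the highest level s_k.
module Submission where

open import Defs
open import Data.Nat using (ℕ; _<_; _≤_)
open import Data.Fin.Subset using (Subset; _⊂_; ∣_∣)
open import Data.List using (List; []; map)
open import Data.List.Relation.Unary.All using (All)
open import Data.List.Relation.Unary.Linked using (Linked)
open import Data.Product using (_×_)
open import Function.Bundles using (_⇔_)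
open import Relation.Binary.PropositionalEquality using (_≡_; _≢_)

open import Algebra.Bundles using (CommutativeMonoid)
import Algebra.Properties.CommutativeSemigroup as CommutativeSemigroupProperties
open import Data.Bool using (Bool)
open import Data.Bool.Properties using (¬-not)
open import Data.Empty using (⊥; ⊥-elim)
open import Data.Fin using (Fin; zero; suc)
open import Data.Fin.Properties using (any?)
open import Data.Fin.Subset using (inside; outside; _∈_; _∉_; _⊆_)
open import Data.Fin.Subset.Properties
  using (_∈?_; drop-∷-⊆; s⊆s; out⊆; ⊆-refl; ⊆-antisym; p⊆q⇒∣p∣≤∣q∣; p⊂q⇒p⊆q; p⊂q⇒∣p∣<∣q∣)
open import Data.List using (_∷_)
open import Data.List.Membership.Propositional using () renaming (_∈_ to _∈ₗ_)
open import Data.List.Relation.Unary.All using (_∷_)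
import Data.List.Relation.Unary.All as All
import Data.List.Relation.Unary.All.Properties as All
import Data.List.Relation.Unary.Any as Any
open import Data.List.Relation.Unary.Linked using ([]; [-]; _∷_)
import Data.List.Relation.Unary.Linked as Linked
import Data.List.Relation.Unary.Linked.Properties as Linked
open import Data.Nat using (z≤n; s≤s; _+_; _∸_; _≤?_)
open import Data.Nat.Properties
  using (≤-refl; ≤-pred; <-irrefl; <-trans; <⇒≤; <-≤-trans; ≤-antisym; ≰⇒>; ≮⇒≥;
         +-suc; +-identityʳ; m+[n∸m]≡n)
open import Data.Product using (∃; Σ; _,_; proj₁; proj₂; uncurry)
open import Data.Rational as ℚ using (ℚ; 0ℚ; 1ℚ; -_)
import Data.Rational.Properties as ℚₚ
open import Data.Rational.Solver using (module +-*-Solver)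
open +-*-Solver using (solve; _:+_; _:*_; _:=_; con)
open import Data.Sum using (_⊎_; inj₁; inj₂)
import Data.Sum as Sum
open import Data.Vec using (_∷_; []; lookup; _[_]≔_)
open Data.Vec._[_]=_
open import Data.Vec.Properties using ([]=⇒lookup; lookup⇒[]=; []≔-updates)
open import Function using (_∘_)
open import Function.Bundles using (mk⇔)
open import Relation.Binary.PropositionalEquality
  using (module ≡-Reasoning; refl; sym; trans; cong; cong₂; subst; subst₂)
open import Relation.Nullary using (yes; no)
open import Relation.Nullary.Decidable using (from-yes; decidable-stable; _×-dec_; ¬?)

private
  variable
    n : ℕ

-- Subsets of [n]

⊆⊎∃∈∉ : (p q : Subset n) → p ⊆ q ⊎ ∃ λ x → x ∈ p × x ∉ q
⊆⊎∃∈∉ p q with any? (λ x → x ∈? p ×-dec ¬? (x ∈? q))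
... | yes witness = inj₂ witness
... | no ∄witness = inj₁ λ {x} x∈p → decidable-stable (x ∈? q) (λ x∉q → ∄witness (x , x∈p , x∉q))

⊆∧≢⇒⊂ : {p q : Subset n} → p ⊆ q → p ≢ q → p ⊂ q
⊆∧≢⇒⊂ {p = p} {q} p⊆q p≢q with ⊆⊎∃∈∉ q p
... | inj₁ q⊆p = ⊥-elim (p≢q (⊆-antisym p⊆q q⊆p))
... | inj₂ witness = p⊆q , witness

⊆∧≢⇒∣p∣<∣q∣ : {p q : Subset n} → p ⊆ q → p ≢ q → ∣ p ∣ < ∣ q ∣
⊆∧≢⇒∣p∣<∣q∣ p⊆q p≢q = p⊂q⇒∣p∣<∣q∣ (⊆∧≢⇒⊂ p⊆q p≢q)

∣p∣<∣q∣⇒p≢q : {p q : Subset n} → ∣ p ∣ < ∣ q ∣ → p ≢ q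
∣p∣<∣q∣⇒p≢q ∣p∣<∣p∣ refl = <-irrefl refl ∣p∣<∣p∣

subsetOfSize : ∀ {k} → k ≤ n → ∃ λ (p : Subset n) → ∣ p ∣ ≡ k
subsetOfSize {ℕ.zero} {ℕ.zero} z≤n = [] , refl
subsetOfSize {ℕ.suc n} {ℕ.zero} z≤n with subsetOfSize {n} z≤n
... | p , ∣p∣≡0 = outside ∷ p , ∣p∣≡0
subsetOfSize (s≤s k≤n) with subsetOfSize k≤n
... | p , ∣p∣≡k = inside ∷ p , cong ℕ.suc ∣p∣≡k

∣[]≔inside∣ : {p : Subset n} {x : Fin n} → x ∉ p → ∣ p [ x ]≔ inside ∣ ≡ ℕ.suc ∣ p ∣
∣[]≔inside∣ {p = inside  ∷ p} {zero}  x∉p = ⊥-elim (x∉p here)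
∣[]≔inside∣ {p = outside ∷ p} {zero}  _   = refl
∣[]≔inside∣ {p = inside  ∷ p} {suc x} x∉p = cong ℕ.suc (∣[]≔inside∣ (x∉p ∘ there))
∣[]≔inside∣ {p = outside ∷ p} {suc x} x∉p = ∣[]≔inside∣ (x∉p ∘ there)

∣[]≔outside∣ : {p : Subset n} {x : Fin n} → x ∈ p → ℕ.suc ∣ p [ x ]≔ outside ∣ ≡ ∣ p ∣
∣[]≔outside∣ {p = inside  ∷ p} {zero}  here        = refl
∣[]≔outside∣ {p = inside  ∷ p} {suc x} (there x∈p) = cong ℕ.suc (∣[]≔outside∣ x∈p)
∣[]≔outside∣ {p = outside ∷ p} {suc x} (there x∈p) = ∣[]≔outside∣ x∈p

[]≔outside-⊆ : {p : Subset n} {x : Fin n} → p [ x ]≔ outside ⊆ p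
[]≔outside-⊆ {p = b ∷ p} {zero}  (there y∈p) = there y∈p
[]≔outside-⊆ {p = b ∷ p} {suc x} here        = here
[]≔outside-⊆ {p = b ∷ p} {suc x} (there y∈p) = there ([]≔outside-⊆ y∈p)

-- Linear functionals on {0,1}ⁿ

val-[]≔inside : (ℓ : Fin n → ℚ) {p : Subset n} {x : Fin n} → x ∉ p →
                val ℓ (p [ x ]≔ inside) ≡ val ℓ p ℚ.+ ℓ x
val-[]≔inside ℓ {inside ∷ p} {zero} x∉p = ⊥-elim (x∉p here)
val-[]≔inside ℓ {outside ∷ p} {zero} _ =
  solve 2 (λ a r → a :* con 1ℚ :+ r := (a :* con 0ℚ :+ r) :+ a) refl (ℓ zero) (val (ℓ ∘ suc) p)
val-[]≔inside ℓ {b ∷ p} {suc x} x∉p =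
  trans (cong (ℓ zero ℚ.* b2q b ℚ.+_) (val-[]≔inside (ℓ ∘ suc) (x∉p ∘ there)))
        (sym (ℚₚ.+-assoc (ℓ zero ℚ.* b2q b) (val (ℓ ∘ suc) p) (ℓ (suc x))))

val-[]≔outside : (ℓ : Fin n → ℚ) {p : Subset n} {x : Fin n} → x ∈ p →
                 val ℓ (p [ x ]≔ outside) ℚ.+ ℓ x ≡ val ℓ p
val-[]≔outside ℓ {inside ∷ p} {zero} here =
  solve 2 (λ a r → (a :* con 0ℚ :+ r) :+ a := a :* con 1ℚ :+ r) refl (ℓ zero) (val (ℓ ∘ suc) p)
val-[]≔outside ℓ {b ∷ p} {suc x} (there x∈p) =
  trans (ℚₚ.+-assoc (ℓ zero ℚ.* b2q b) (val (ℓ ∘ suc) (p [ x ]≔ outside)) (ℓ (suc x)))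
        (cong (ℓ zero ℚ.* b2q b ℚ.+_) (val-[]≔outside (ℓ ∘ suc) x∈p))

exchange : Subset n → Fin n → Fin n → Subset n
exchange p x y = p [ x ]≔ outside [ y ]≔ inside

module _ {p : Subset n} {x y : Fin n} (x∈p : x ∈ p) (y∉p : y ∉ p) where

  private
    y∉p-x : y ∉ p [ x ]≔ outside
    y∉p-x = y∉p ∘ []≔outside-⊆

  ∣exchange∣ : ∣ exchange p x y ∣ ≡ ∣ p ∣
  ∣exchange∣ = trans (∣[]≔inside∣ y∉p-x) (∣[]≔outside∣ x∈p)

  val-exchange : (ℓ : Fin n → ℚ) → val ℓ (exchange p x y) ℚ.+ ℓ x ≡ val ℓ p ℚ.+ ℓ y
  val-exchange ℓ = begin
    val ℓ (exchange p x y) ℚ.+ ℓ x                  ≡⟨ cong (ℚ._+ ℓ x) (val-[]≔inside ℓ y∉p-x) ⟩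
    (val ℓ (p [ x ]≔ outside) ℚ.+ ℓ y) ℚ.+ ℓ x      ≡⟨ xy∙z≈xz∙y (val ℓ (p [ x ]≔ outside)) (ℓ y) (ℓ x) ⟩
    (val ℓ (p [ x ]≔ outside) ℚ.+ ℓ x) ℚ.+ ℓ y      ≡⟨ cong (ℚ._+ ℓ y) (val-[]≔outside ℓ x∈p) ⟩
    val ℓ p ℚ.+ ℓ y                                 ∎
    where
    open ≡-Reasoning
    open CommutativeSemigroupProperties (CommutativeMonoid.commutativeSemigroup ℚₚ.+-0-commutativeMonoid)
      using (xy∙z≈xz∙y)

sumℚ-cong : {f g : Fin n → ℚ} → (∀ i → f i ≡ g i) → sumℚ f ≡ sumℚ g
sumℚ-cong {ℕ.zero}  _   = refl
sumℚ-cong {ℕ.suc n} f≡g = cong₂ ℚ._+_ (f≡g zero) (sumℚ-cong (f≡g ∘ suc))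

sumℚ-mono-≤ : {f g : Fin n → ℚ} → (∀ i → f i ℚ.≤ g i) → sumℚ f ℚ.≤ sumℚ g
sumℚ-mono-≤ {ℕ.zero}  _   = ℚₚ.≤-refl
sumℚ-mono-≤ {ℕ.suc n} f≤g = ℚₚ.+-mono-≤ (f≤g zero) (sumℚ-mono-≤ (f≤g ∘ suc))

sumℚ-mono-< : {f g : Fin n → ℚ} → (∀ i → f i ℚ.≤ g i) → ∀ i → f i ℚ.< g i → sumℚ f ℚ.< sumℚ g
sumℚ-mono-< f≤g zero    fᵢ<gᵢ = ℚₚ.+-mono-<-≤ fᵢ<gᵢ (sumℚ-mono-≤ (f≤g ∘ suc))
sumℚ-mono-< f≤g (suc i) fᵢ<gᵢ = ℚₚ.+-mono-≤-< (f≤g zero) (sumℚ-mono-< (f≤g ∘ suc) i fᵢ<gᵢ)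

intervalWeight : Bool → Bool → ℚ
intervalWeight inside  _       = 1ℚ
intervalWeight outside inside  = 0ℚ
intervalWeight outside outside = - 1ℚ

intervalFunctional : Subset n → Subset n → Fin n → ℚ
intervalFunctional u v i = intervalWeight (lookup u i) (lookup v i)

module _ {a b c : Bool} where

  intervalWeight-drop : a ≡ inside → c ≡ outside →
                        intervalWeight a b ℚ.* b2q c ℚ.< intervalWeight a b ℚ.* b2q a
  intervalWeight-drop refl refl = from-yes (1ℚ ℚ.* 0ℚ ℚ.<? 1ℚ ℚ.* 1ℚ)

  intervalWeight-escape : a ≡ outside → b ≡ outside → c ≡ inside →
                          intervalWeight a b ℚ.* b2q c ℚ.< intervalWeight a b ℚ.* b2q a
  intervalWeight-escape refl refl refl = from-yes (- 1ℚ ℚ.* 1ℚ ℚ.<? - 1ℚ ℚ.* 0ℚ)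

intervalWeight-max : ∀ a b c → intervalWeight a b ℚ.* b2q c ℚ.≤ intervalWeight a b ℚ.* b2q a
intervalWeight-max inside  _       inside  = ℚₚ.≤-refl
intervalWeight-max inside  b       outside = ℚₚ.<⇒≤ (intervalWeight-drop {b = b} refl refl)
intervalWeight-max outside inside  inside  = ℚₚ.≤-refl
intervalWeight-max outside inside  outside = ℚₚ.≤-refl
intervalWeight-max outside outside inside  = ℚₚ.<⇒≤ (intervalWeight-escape refl refl refl)
intervalWeight-max outside outside outside = ℚₚ.≤-refl

intervalWeight-endpoints : ∀ a b → (a ≡ inside → b ≡ inside) →
                           intervalWeight a b ℚ.* b2q a ≡ intervalWeight a b ℚ.* b2q b
intervalWeight-endpoints inside  inside  _   = refl
intervalWeight-endpoints inside  outside a⇒b with () ← a⇒b refl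
intervalWeight-endpoints outside inside  _   = refl
intervalWeight-endpoints outside outside _   = refl

∉⇒lookup≡outside : {p : Subset n} {x : Fin n} → x ∉ p → lookup p x ≡ outside
∉⇒lookup≡outside {p = p} {x} x∉p = ¬-not (x∉p ∘ lookup⇒[]= x p)

module _ {u v : Subset n} (u⊆v : u ⊆ v) where

  interval-endpoints : val (intervalFunctional u v) u ≡ val (intervalFunctional u v) v
  interval-endpoints = sumℚ-cong λ i →
    intervalWeight-endpoints (lookup u i) (lookup v i) ([]=⇒lookup ∘ u⊆v ∘ lookup⇒[]= i u)

  private
    termwise-≤ : ∀ w i → intervalFunctional u v i ℚ.* b2q (lookup w i)
                         ℚ.≤ intervalFunctional u v i ℚ.* b2q (lookup u i)
    termwise-≤ w i = intervalWeight-max (lookup u i) (lookup v i) (lookup w i)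

  interval-max : ∀ w → val (intervalFunctional u v) w ℚ.< val (intervalFunctional u v) u
                       ⊎ (u ⊆ w × w ⊆ v)
  interval-max w with ⊆⊎∃∈∉ u w | ⊆⊎∃∈∉ w v
  ... | inj₁ u⊆w | inj₁ w⊆v = inj₂ (u⊆w , w⊆v)
  ... | inj₂ (i , i∈u , i∉w) | _ = inj₁ (sumℚ-mono-< (termwise-≤ w) i
          (intervalWeight-drop ([]=⇒lookup i∈u) (∉⇒lookup≡outside i∉w)))
  ... | inj₁ _ | inj₂ (i , i∈w , i∉v) = inj₁ (sumℚ-mono-< (termwise-≤ w) i
          (intervalWeight-escape (∉⇒lookup≡outside (i∉v ∘ u⊆v)) (∉⇒lookup≡outside i∉v)
                                 ([]=⇒lookup i∈w)))

AboveEndpoint : (Fin n → ℚ) → Subset n → Subset n → Subset n → Set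
AboveEndpoint ℓ u v w = val ℓ u ℚ.≤ val ℓ w ⊎ val ℓ v ℚ.≤ val ℓ w

module _ (ℓ : Fin (ℕ.suc n) → ℚ) {u v w : Subset n} where

  aboveEndpoint-∷ : ∀ b → AboveEndpoint (ℓ ∘ suc) u v w → AboveEndpoint ℓ (b ∷ u) (b ∷ v) (b ∷ w)
  aboveEndpoint-∷ b = Sum.map (ℚₚ.+-monoʳ-≤ (ℓ zero ℚ.* b2q b)) (ℚₚ.+-monoʳ-≤ (ℓ zero ℚ.* b2q b))

  aboveEndpoint-include : 0ℚ ℚ.≤ ℓ zero → AboveEndpoint (ℓ ∘ suc) u v w →
                          AboveEndpoint ℓ (outside ∷ u) (inside ∷ v) (inside ∷ w)
  aboveEndpoint-include 0≤ℓ₀ = Sum.map (ℚₚ.+-mono-≤ ℓ₀*0≤ℓ₀*1) (ℚₚ.+-monoʳ-≤ (ℓ zero ℚ.* 1ℚ))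
    where
    ℓ₀*0≤ℓ₀*1 : ℓ zero ℚ.* 0ℚ ℚ.≤ ℓ zero ℚ.* 1ℚ
    ℓ₀*0≤ℓ₀*1 = subst₂ ℚ._≤_ (sym (ℚₚ.*-zeroʳ (ℓ zero))) (sym (ℚₚ.*-identityʳ (ℓ zero))) 0≤ℓ₀

  aboveEndpoint-exclude : ℓ zero ℚ.≤ 0ℚ → AboveEndpoint (ℓ ∘ suc) u v w →
                          AboveEndpoint ℓ (outside ∷ u) (inside ∷ v) (outside ∷ w)
  aboveEndpoint-exclude ℓ₀≤0 = Sum.map (ℚₚ.+-monoʳ-≤ (ℓ zero ℚ.* 0ℚ)) (ℚₚ.+-mono-≤ ℓ₀*1≤ℓ₀*0)
    where
    ℓ₀*1≤ℓ₀*0 : ℓ zero ℚ.* 1ℚ ℚ.≤ ℓ zero ℚ.* 0ℚ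
    ℓ₀*1≤ℓ₀*0 = subst₂ ℚ._≤_ (sym (ℚₚ.*-identityʳ (ℓ zero))) (sym (ℚₚ.*-zeroʳ (ℓ zero))) ℓ₀≤0

-- Greedy: an element of v ∖ u is taken when its weight is nonnegative, and skipped when it is
-- negative unless the remaining elements are all needed to reach the size.
intervalPoint : (ℓ : Fin n → ℚ) {u v : Subset n} → u ⊆ v → ∀ k → ∣ u ∣ + k ≤ ∣ v ∣ →
                ∃ λ w → u ⊆ w × w ⊆ v × ∣ w ∣ ≡ ∣ u ∣ + k × AboveEndpoint ℓ u v w
intervalPoint ℓ {u} u⊆v ℕ.zero _ = u , ⊆-refl , u⊆v , sym (+-identityʳ ∣ u ∣) , inj₁ ℚₚ.≤-refl
intervalPoint ℓ {[]} {[]} _ (ℕ.suc k) ()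
intervalPoint ℓ {inside ∷ u} {outside ∷ v} u⊆v (ℕ.suc k) _ with () ← u⊆v here
intervalPoint ℓ {inside ∷ u} {inside ∷ v} u⊆v (ℕ.suc k) (s≤s room)
  with intervalPoint (ℓ ∘ suc) (drop-∷-⊆ u⊆v) (ℕ.suc k) room
... | w , u⊆w , w⊆v , ∣w∣ , above =
  inside ∷ w , s⊆s u⊆w , s⊆s w⊆v , cong ℕ.suc ∣w∣ , aboveEndpoint-∷ ℓ {u} {v} {w} inside above
intervalPoint ℓ {outside ∷ u} {outside ∷ v} u⊆v (ℕ.suc k) room
  with intervalPoint (ℓ ∘ suc) (drop-∷-⊆ u⊆v) (ℕ.suc k) room
... | w , u⊆w , w⊆v , ∣w∣ , above =
  outside ∷ w , s⊆s u⊆w , s⊆s w⊆v , ∣w∣ , aboveEndpoint-∷ ℓ {u} {v} {w} outside above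
intervalPoint ℓ {outside ∷ u} {inside ∷ v} u⊆v (ℕ.suc k) room
  with ∣ u ∣ + ℕ.suc k ≤? ∣ v ∣ | 0ℚ ℚ.≤? ℓ zero
... | no full | _ =
  inside ∷ v , out⊆ (drop-∷-⊆ u⊆v) , ⊆-refl , ≤-antisym (≰⇒> full) room , inj₂ ℚₚ.≤-refl
... | yes room′ | no ℓ₀≱0
  with intervalPoint (ℓ ∘ suc) (drop-∷-⊆ u⊆v) (ℕ.suc k) room′
...   | w , u⊆w , w⊆v , ∣w∣ , above =
  outside ∷ w , s⊆s u⊆w , out⊆ w⊆v , ∣w∣ ,
  aboveEndpoint-exclude ℓ {u} {v} {w} (ℚₚ.<⇒≤ (ℚₚ.≰⇒> ℓ₀≱0)) above
intervalPoint ℓ {outside ∷ u} {inside ∷ v} u⊆v (ℕ.suc k) room | yes _ | yes 0≤ℓ₀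
  with intervalPoint (ℓ ∘ suc) (drop-∷-⊆ u⊆v) k
                     (≤-pred (subst (_≤ ℕ.suc ∣ v ∣) (+-suc ∣ u ∣ k) room))
...   | w , u⊆w , w⊆v , ∣w∣ , above =
  inside ∷ w , out⊆ u⊆w , s⊆s w⊆v , trans (cong ℕ.suc ∣w∣) (sym (+-suc ∣ u ∣ k)) ,
  aboveEndpoint-include ℓ {u} {v} {w} 0≤ℓ₀ above

-- Sorted lists

head<∈tail : ∀ {x y xs} → Linked _<_ (x ∷ xs) → y ∈ₗ xs → x < y
head<∈tail (x<y ∷ _)      (Any.here refl) = x<y
head<∈tail (x<x′ ∷ sorted) (Any.there y∈xs) = <-trans x<x′ (head<∈tail sorted y∈xs)

head≤∈ : ∀ {x y xs} → Linked _<_ (x ∷ xs) → y ∈ₗ x ∷ xs → x ≤ y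
head≤∈ _      (Any.here refl)  = ≤-refl
head≤∈ sorted (Any.there y∈xs) = <⇒≤ (head<∈tail sorted y∈xs)

∈≤last : ∀ {xs y z} → Linked _<_ xs → Last xs z → y ∈ₗ xs → y ≤ z
∈≤last _               here      (Any.here refl)  = ≤-refl
∈≤last (x<x′ ∷ sorted) (there L) (Any.here refl)  = <⇒≤ (<-≤-trans x<x′ (∈≤last sorted L (Any.here refl)))
∈≤last (_ ∷ sorted)    (there L) (Any.there y∈xs) = ∈≤last sorted L y∈xs

last : ∀ {A : Set} (x : A) xs → ∃ (Last (x ∷ xs))
last x []       = x , here
last x (y ∷ xs) with last y xs
... | z , L = z , there L

Last-map : ∀ {A B : Set} {xs : List A} {z} (f : A → B) → Last xs z → Last (map f xs) (f z)
Last-map f here      = here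
Last-map f (there L) = there (Last-map f L)

Consecutive : List ℕ → ℕ → ℕ → Set
Consecutive xs a b = a < b × (∀ {y} → y ∈ₗ xs → a < y → y < b → ⊥)

consecutive-∷ : ∀ {x xs ys} → All (x <_) ys → Linked (Consecutive xs) ys → Linked (Consecutive (x ∷ xs)) ys
consecutive-∷ _                 []  = []
consecutive-∷ _                 [-] = [-]
consecutive-∷ (x<a ∷ below) ((a<b , nothing-between) ∷ steps) =
  (a<b , λ { (Any.here refl) a<x _ → <-irrefl refl (<-trans x<a a<x)
           ; (Any.there y∈xs) → nothing-between y∈xs })
  ∷ consecutive-∷ below steps

consecutive-tail : ∀ {x xs a b} → Consecutive (x ∷ xs) a b → Consecutive xs a b
consecutive-tail (a<b , nothing-between) = a<b , λ y∈xs → nothing-between (Any.there y∈xs)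

sorted⇒consecutive : ∀ {xs} → Linked _<_ xs → Linked (Consecutive xs) xs
sorted⇒consecutive []  = []
sorted⇒consecutive [-] = [-]
sorted⇒consecutive {a ∷ b ∷ xs} (a<b ∷ sorted) =
  (a<b , nothing-between) ∷ consecutive-∷ (Linked.Linked⇒All <-trans a<b sorted) (sorted⇒consecutive sorted)
  where
  nothing-between : ∀ {y} → y ∈ₗ a ∷ b ∷ xs → a < y → y < b → ⊥
  nothing-between (Any.here refl)             a<a _   = <-irrefl refl a<a
  nothing-between (Any.there (Any.here refl)) _   b<b = <-irrefl refl b<b
  nothing-between (Any.there (Any.there y∈xs)) _  y<b = <-irrefl refl (<-trans y<b (head<∈tail sorted y∈xs))

∈-tail : ∀ {x y xs} → y ∈ₗ x ∷ xs → x < y → y ∈ₗ xs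
∈-tail (Any.here refl)  x<x = ⊥-elim (<-irrefl refl x<x)
∈-tail (Any.there y∈xs) _   = y∈xs

consecutiveWalk≡ : ∀ {xs y ys} → Linked _<_ xs → All (_∈ₗ xs) (y ∷ ys) → Linked (Consecutive xs) (y ∷ ys) →
                   (∀ {x} → x ∈ₗ xs → y ≤ x) → (Σ ℕ λ z → Last (y ∷ ys) z × (∀ {x} → x ∈ₗ xs → x ≤ z)) →
                   y ∷ ys ≡ xs
consecutiveWalk≡ {[]} _ (() ∷ _) _ _ _
consecutiveWalk≡ {x ∷ xs} sorted (y∈ ∷ _) _ lowest _
  with ≤-antisym (lowest (Any.here refl)) (head≤∈ sorted y∈)
consecutiveWalk≡ {x ∷ []} _ _ _ _ (_ , here , _) | refl = refl
consecutiveWalk≡ {x ∷ x′ ∷ xs} sorted _ _ _ (_ , here , highest) | refl =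
  ⊥-elim (<-irrefl refl (<-≤-trans (Linked.head sorted) (highest (Any.there (Any.here refl)))))
consecutiveWalk≡ {x ∷ xs} {ys = ys@(y′ ∷ _)} sorted (_ ∷ ys∈) ((x<y′ , nothing-between) ∷ steps) _
  (z , there L , highest) | refl =
  cong (x ∷_) (consecutiveWalk≡ (Linked.tail sorted) ys∈′ steps′ lowest′ (z , L , highest ∘ Any.there))
  where
  ys∈′ : All (_∈ₗ xs) ys
  ys∈′ = All.zipWith (uncurry ∈-tail) (ys∈ , Linked.Linked⇒All <-trans x<y′ (Linked.map proj₁ steps))
  steps′ : Linked (Consecutive xs) ys
  steps′ = Linked.map consecutive-tail steps
  lowest′ : ∀ {x′} → x′ ∈ₗ xs → y′ ≤ x′
  lowest′ x′∈xs = ≮⇒≥ (nothing-between (Any.there x′∈xs) (head<∈tail sorted x′∈xs))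

-- Edges of Δ(d,S)

module _ {d : ℕ} {ss : List ℕ} {u v : Subset d} where

  ⊆×consecutive⇒edge : InS ss u → InS ss v → u ⊆ v → Consecutive ss ∣ u ∣ ∣ v ∣ → IsEdge d ss u v
  ⊆×consecutive⇒edge u∈V v∈V u⊆v (∣u∣<∣v∣ , nothing-between) =
    ∣p∣<∣q∣⇒p≢q ∣u∣<∣v∣ , u∈V , v∈V , intervalFunctional u v , interval-endpoints u⊆v , below
    where
    below : ∀ w → InS ss w → w ≢ u → w ≢ v →
            val (intervalFunctional u v) w ℚ.< val (intervalFunctional u v) u
    below w w∈V w≢u w≢v with interval-max u⊆v w
    ... | inj₁ w<u = w<u
    ... | inj₂ (u⊆w , w⊆v) =
      ⊥-elim (nothing-between w∈V (⊆∧≢⇒∣p∣<∣q∣ u⊆w (w≢u ∘ sym)) (⊆∧≢⇒∣p∣<∣q∣ w⊆v w≢v))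

  edge⇒⊆ : IsEdge d ss u v → ∣ u ∣ < ∣ v ∣ → u ⊆ v
  edge⇒⊆ (_ , u∈V , v∈V , ℓ , ℓu≡ℓv , below) ∣u∣<∣v∣ with ⊆⊎∃∈∉ u v | ⊆⊎∃∈∉ v u
  ... | inj₁ u⊆v | _ = u⊆v
  ... | inj₂ _ | inj₁ v⊆u = ⊥-elim (<-irrefl refl (<-≤-trans ∣u∣<∣v∣ (p⊆q⇒∣p∣≤∣q∣ v⊆u)))
  ... | inj₂ (i , i∈u , i∉v) | inj₂ (j , j∈v , j∉u) = ⊥-elim (ℚₚ.<-irrefl sum≡ sum<)
    where
    w₁ w₂ : Subset d
    w₁ = exchange u i j
    w₂ = exchange v j i
    ∣w₁∣ : ∣ w₁ ∣ ≡ ∣ u ∣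
    ∣w₁∣ = ∣exchange∣ i∈u j∉u
    ∣w₂∣ : ∣ w₂ ∣ ≡ ∣ v ∣
    ∣w₂∣ = ∣exchange∣ j∈v i∉v
    w₁<v : val ℓ w₁ ℚ.< val ℓ v
    w₁<v = subst (val ℓ w₁ ℚ.<_) ℓu≡ℓv (below w₁ (subst (_∈ₗ ss) (sym ∣w₁∣) u∈V)
      (λ w₁≡u → j∉u (subst (j ∈_) w₁≡u ([]≔-updates _ j)))
      (∣p∣<∣q∣⇒p≢q (subst (_< ∣ v ∣) (sym ∣w₁∣) ∣u∣<∣v∣)))
    w₂<u : val ℓ w₂ ℚ.< val ℓ u
    w₂<u = below w₂ (subst (_∈ₗ ss) (sym ∣w₂∣) v∈V)
      (∣p∣<∣q∣⇒p≢q (subst (∣ u ∣ <_) (sym ∣w₂∣) ∣u∣<∣v∣) ∘ sym)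
      (λ w₂≡v → i∉v (subst (i ∈_) w₂≡v ([]≔-updates _ i)))
    sum≡ : (val ℓ w₁ ℚ.+ ℓ i) ℚ.+ (val ℓ w₂ ℚ.+ ℓ j) ≡ (val ℓ v ℚ.+ ℓ i) ℚ.+ (val ℓ u ℚ.+ ℓ j)
    sum≡ = trans (cong₂ ℚ._+_ (val-exchange i∈u j∉u ℓ) (val-exchange j∈v i∉v ℓ))
                 (ℚₚ.+-comm (val ℓ u ℚ.+ ℓ j) (val ℓ v ℚ.+ ℓ i))
    sum< : (val ℓ w₁ ℚ.+ ℓ i) ℚ.+ (val ℓ w₂ ℚ.+ ℓ j) ℚ.< (val ℓ v ℚ.+ ℓ i) ℚ.+ (val ℓ u ℚ.+ ℓ j)
    sum< = ℚₚ.+-mono-< (ℚₚ.+-monoˡ-< (ℓ i) w₁<v) (ℚₚ.+-monoˡ-< (ℓ j) w₂<u)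

  edge∧⊆⇒consecutive : IsEdge d ss u v → u ⊆ v → ∣ u ∣ < ∣ v ∣ → Consecutive ss ∣ u ∣ ∣ v ∣
  edge∧⊆⇒consecutive (_ , _ , _ , ℓ , ℓu≡ℓv , below) u⊆v ∣u∣<∣v∣ = ∣u∣<∣v∣ , nothing-between
    where
    nothing-between : ∀ {y} → y ∈ₗ ss → ∣ u ∣ < y → y < ∣ v ∣ → ⊥
    nothing-between {y} y∈ss ∣u∣<y y<∣v∣
      with intervalPoint ℓ u⊆v (y ∸ ∣ u ∣)
                         (subst (_≤ ∣ v ∣) (sym (m+[n∸m]≡n (<⇒≤ ∣u∣<y))) (<⇒≤ y<∣v∣))
    ... | w , _ , _ , ∣w∣ , above = ℚₚ.<-irrefl refl (ℚₚ.≤-<-trans (u≤w above) w<u)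
      where
      ∣w∣≡y : ∣ w ∣ ≡ y
      ∣w∣≡y = trans ∣w∣ (m+[n∸m]≡n (<⇒≤ ∣u∣<y))
      u≤w : AboveEndpoint ℓ u v w → val ℓ u ℚ.≤ val ℓ w
      u≤w (inj₁ u≤w) = u≤w
      u≤w (inj₂ v≤w) = subst (ℚ._≤ val ℓ w) (sym ℓu≡ℓv) v≤w
      w<u : val ℓ w ℚ.< val ℓ u
      w<u = below w (subst (_∈ₗ ss) (sym ∣w∣≡y) y∈ss)
        (∣p∣<∣q∣⇒p≢q (subst (∣ u ∣ <_) (sym ∣w∣≡y) ∣u∣<y) ∘ sym)
        (∣p∣<∣q∣⇒p≢q (subst (_< ∣ v ∣) (sym ∣w∣≡y) y<∣v∣))

  edge⇒⊆×consecutive : IsEdge d ss u v → ∣ u ∣ < ∣ v ∣ → u ⊆ v × Consecutive ss ∣ u ∣ ∣ v ∣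
  edge⇒⊆×consecutive edge ∣u∣<∣v∣ = u⊆v , edge∧⊆⇒consecutive edge u⊆v ∣u∣<∣v∣
    where
    u⊆v : u ⊆ v
    u⊆v = edge⇒⊆ edge ∣u∣<∣v∣

-- Monotone paths

levelPoint : ∀ {d ss y} → All (_≤ d) ss → y ∈ₗ ss → ∃ λ (w : Pt d) → InS ss w × ∣ w ∣ ≡ y
levelPoint bounded y∈ss with subsetOfSize (All.lookup bounded y∈ss)
... | w , ∣w∣≡y = w , subst (_∈ₗ _) (sym ∣w∣≡y) y∈ss , ∣w∣≡y

monotonePath⇒chain : ∀ {d ss} → Linked _<_ ss → All (_≤ d) ss → (vs : List (Pt d)) →
                     MonotonePath d ss vs → Linked _⊂_ vs × map ∣_∣ vs ≡ ss
monotonePath⇒chain {ss = ss} sorted bounded (v ∷ vs)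
  (vertices , edges , increasing , minimal , z , L , maximal) =
  Linked.map (λ (u⊆w , ∣u∣<∣w∣ , _) → ⊆∧≢⇒⊂ u⊆w (∣p∣<∣q∣⇒p≢q ∣u∣<∣w∣)) steps ,
  consecutiveWalk≡ sorted (All.map⁺ (All.map proj₁ vertices)) (Linked.map⁺ (Linked.map proj₂ steps))
                   lowest (∣ z ∣ , Last-map ∣_∣ L , highest)
  where
  steps : Linked (λ u w → u ⊆ w × Consecutive ss ∣ u ∣ ∣ w ∣) (v ∷ vs)
  steps = Linked.zipWith (uncurry edge⇒⊆×consecutive) (edges , increasing)
  lowest : ∀ {y} → y ∈ₗ ss → ∣ v ∣ ≤ y
  lowest y∈ss with levelPoint bounded y∈ss
  ... | w , w∈V , refl = minimal w w∈V
  highest : ∀ {y} → y ∈ₗ ss → y ≤ ∣ z ∣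
  highest y∈ss with levelPoint bounded y∈ss
  ... | w , w∈V , refl = maximal w w∈V

chain⇒edges : ∀ {d ss} {vs : List (Pt d)} → All (InS ss) vs → Linked _⊂_ vs →
              Linked (Consecutive ss) (map ∣_∣ vs) → Linked (IsEdge d ss) vs
chain⇒edges _                       []             []             = []
chain⇒edges _                       [-]            [-]            = [-]
chain⇒edges (u∈V ∷ vs∈V@(v∈V ∷ _)) (u⊂v ∷ chain) (step ∷ steps) =
  ⊆×consecutive⇒edge u∈V v∈V (p⊂q⇒p⊆q u⊂v) step ∷ chain⇒edges vs∈V chain steps

chain⇒monotonePath : ∀ {d ss} → ss ≢ [] → Linked _<_ ss → (vs : List (Pt d)) → All (IsVertex d ss) vs →
                     Linked _⊂_ vs × map ∣_∣ vs ≡ ss → MonotonePath d ss vs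
chain⇒monotonePath ss≢[] _ [] _ (_ , refl) = ⊥-elim (ss≢[] refl)
chain⇒monotonePath _ sorted (v ∷ vs) vertices (chain , refl) with last v vs
... | z , L =
  vertices , chain⇒edges (All.map proj₁ vertices) chain (sorted⇒consecutive sorted) , Linked.map⁻ sorted ,
  (λ _ → head≤∈ sorted) , z , L , (λ _ → ∈≤last sorted (Last-map ∣_∣ L))

corollary4p1 : (d : ℕ) (ss : List ℕ) → ss ≢ [] → Linked _<_ ss → All (_≤ d) ss →
    Proper d ss → (vs : List (Subset d)) → All (IsVertex d ss) vs →
    MonotonePath d ss vs ⇔ (Linked _⊂_ vs × map ∣_∣ vs ≡ ss)
-- Properness is not needed: the description of the edges holds for every S.
corollary4p1 d ss ss≢[] sorted bounded _ vs vertices =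
  mk⇔ (monotonePath⇒chain sorted bounded vs) (chain⇒monotonePath ss≢[] sorted vs vertices)
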